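{- Let $k\geqslant 1$ and $m\geqslant 1$ be integers such that $m$ is not divisible by $k$. Then $R_k(km)=(k-1)m$.
   Context: A set $A\subset \mathbb{Z}/n\mathbb{Z}$ is called $k$-free if for all $x\in A$, $kx\notin A$. $R_k(n)$ denotes the maximal cardinality of a $k$-free subset of $\mathbb{Z}/n\mathbb{Z}$. -}

module Defs where

open import Data.Nat using (ℕ; suc; _*_; _%_; NonZero)
open import Data.Nat.DivMod using (_mod_)
open import Data.Fin using (Fin; toℕ; fromℕ<)
open import Data.Fin.Subset using (Subset; _∈_; _∉_; ∣_∣)
open import Data.Product using (_×_; Σ)
open import Data.Nat using (_≤_)

-- Multiplication by the integer k in ℤ/nℤ, with ℤ/nℤ represented by Fin n
-- (residues 0, …, n-1).
mulZn : (n : ℕ) → .{{_ : NonZero n}} → ℕ → Fin n → Fin n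
mulZn n k x = (k * toℕ x) mod n

IsKFree : (n : ℕ) → .{{_ : NonZero n}} → ℕ → Subset n → Set
IsKFree n k A = ∀ x → x ∈ A → mulZn n k x ∉ A

IsRk : (n : ℕ) → .{{_ : NonZero n}} → ℕ → ℕ → Set
IsRk n k r =
  Σ (Subset n) (λ A → IsKFree n k A × ∣ A ∣ ≡ r)
  × (∀ (A : Subset n) → IsKFree n k A → ∣ A ∣ ≤ r)
  where open import Relation.Binary.PropositionalEquality using (_≡_)

{-# OPTIONS --safe #-}
-- Multiplication by k maps ℤ/kmℤ into the multiples of k, so the (k − 1)m
-- non-multiples of k form a k-free set. Conversely, for each residue a < m let
-- a′ ∈ {a, a + m} be the one not divisible by k (there is one since k ∤ m).
-- Then k a′ ≡ k a (mod km), and the m pairs {a′, k a} are pairwise disjoint: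
-- the a′ are distinct mod m and not multiples of k, the k a are distinct
-- multiples of k. A k-free set contains at most one point of each pair.
module Submission where

open import Defs
open import Data.Nat using (ℕ; suc; _*_; _∸_; _≥_; NonZero)
open import Data.Nat.Divisibility using (_∣_)
open import Relation.Nullary using (¬_)

open import Data.Bool using (Bool; true; false; T)
open import Data.Bool.Properties using (T-≡)
open import Data.Fin using (Fin; zero; suc; toℕ; fromℕ<)
open import Data.Fin.Properties using (toℕ-fromℕ<; toℕ<n; toℕ-injective; suc-injective; 0≢1+n)
open import Data.Fin.Subset using (Subset; _∈_; _∉_; ∣_∣; ∁; _-_)
open import Data.Fin.Subset.Properties
  using (_∈?_; x∉p⇒x∈∁p; ∣∁p∣≡n∸∣p∣; ∣p∣≤n; x∈p∧x≢y⇒x∈p-y; x∈p⇒∣p-x∣<∣p∣)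
open import Data.Nat using (zero; _+_; _≤_; _<_; _%_; z≤n; s≤s)
open import Data.Nat.DivMod using ([m+n]%n≡m%n; m<n⇒m%n≡m)
open import Data.Nat.Divisibility using (_∣?_; ∣m+n∣m⇒∣n; ∣m∣n⇒∣m+n; ∣-refl; >⇒∤; 1∣_; m∣m*n; %-presˡ-∣)
open import Data.Nat.Properties
  using (≤-trans; <-≤-trans; ≤-<-trans; m≤m+n; +-comm; +-identityʳ; +-monoˡ-<; *-comm; *-zeroʳ; *-suc;
         *-distribˡ-+; *-distribʳ-∸; *-monoˡ-≤; *-monoʳ-<; *-cancelˡ-≡; m*n≢0⇒m≢0; m*n≢0⇒n≢0;
         m+n≤o⇒m≤o∸n; m≤o∸n⇒m+n≤o)
open import Data.Product using (_,_)
open import Data.Vec using (tabulate)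
open import Data.Vec.Properties using ([]=⇒lookup; lookup∘tabulate; tabulate-cong)
open import Function using (_∘_)
open import Function.Bundles using (module Equivalence)
open import Function.Definitions using (Injective)
open import Relation.Nullary using (yes; no; does; contradiction)
open import Relation.Nullary.Decidable using (isNo; fromWitnessFalse; toWitnessFalse)
open import Relation.Binary.PropositionalEquality

injective⇒≤∣p∣ : ∀ {m n} (p : Subset n) (g : Fin m → Fin n) →
  Injective _≡_ _≡_ g → (∀ i → g i ∈ p) → m ≤ ∣ p ∣
injective⇒≤∣p∣ {zero}  p g g-inj g∈p = z≤n
injective⇒≤∣p∣ {suc m} p g g-inj g∈p = ≤-<-trans
  (injective⇒≤∣p∣ (p - g zero) (g ∘ suc) (suc-injective ∘ g-inj)
    (λ i → x∈p∧x≢y⇒x∈p-y (g∈p (suc i)) (0≢1+n ∘ sym ∘ g-inj)))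
  (x∈p⇒∣p-x∣<∣p∣ (g∈p zero))

module _ {m n} (f : Fin n → Fin n) (w : Fin m → Fin n)
         (w-inj : Injective _≡_ _≡_ w) (f∘w-inj : Injective _≡_ _≡_ (f ∘ w))
         (w≢f∘w : ∀ a b → w a ≢ f (w b)) where

  private
    pick : Bool → Fin m → Fin n
    pick true  = w
    pick false = f ∘ w

    pick-injective : ∀ b c {a a′} → pick b a ≡ pick c a′ → a ≡ a′
    pick-injective true  true              = w-inj
    pick-injective true  false {a} {a′} eq = contradiction eq (w≢f∘w a a′)
    pick-injective false true  {a} {a′} eq = contradiction (sym eq) (w≢f∘w a′ a)
    pick-injective false false             = f∘w-inj

  free⇒∣p∣≤n∸m : (A : Subset n) → (∀ x → x ∈ A → f x ∉ A) → ∣ A ∣ ≤ n ∸ m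
  free⇒∣p∣≤n∸m A free = m+n≤o⇒m≤o∸n ∣ A ∣ (subst (_≤ n) (+-comm m ∣ A ∣)
    (m≤o∸n⇒m+n≤o m (∣p∣≤n A) (subst (m ≤_) (∣∁p∣≡n∸∣p∣ A) m≤∣∁A∣)))
    where
    inA : Fin m → Bool
    inA a = does (f (w a) ∈? A)

    missed∈∁A : ∀ a → pick (does (f (w a) ∈? A)) a ∈ ∁ A
    missed∈∁A a with f (w a) ∈? A
    ... | yes fwa∈A = x∉p⇒x∈∁p (λ wa∈A → free (w a) wa∈A fwa∈A)
    ... | no  fwa∉A = x∉p⇒x∈∁p fwa∉A

    m≤∣∁A∣ : m ≤ ∣ ∁ A ∣
    m≤∣∁A∣ = injective⇒≤∣p∣ (∁ A) (λ a → pick (inA a) a)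
      (λ {a} {a′} → pick-injective (inA a) (inA a′)) missed∈∁A

sieve : (ℕ → Bool) → (n : ℕ) → Subset n
sieve P n = tabulate (P ∘ toℕ)

∈-sieve⁻ : ∀ P {n} {x : Fin n} → x ∈ sieve P n → T (P (toℕ x))
∈-sieve⁻ P {x = x} x∈ =
  Equivalence.from T-≡ (trans (sym (lookup∘tabulate (P ∘ toℕ) x)) ([]=⇒lookup x∈))

∣sieve∣-+ : ∀ P a b → ∣ sieve P (a + b) ∣ ≡ ∣ sieve P a ∣ + ∣ sieve (P ∘ (a +_)) b ∣
∣sieve∣-+ P zero    b = refl
∣sieve∣-+ P (suc a) b with P 0
... | true  = cong suc (∣sieve∣-+ (P ∘ suc) a b)
... | false = ∣sieve∣-+ (P ∘ suc) a b

∣sieve∣-periodic : ∀ P k → (∀ x → P (k + x) ≡ P x) →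
  ∀ m → ∣ sieve P (k * m) ∣ ≡ m * ∣ sieve P k ∣
∣sieve∣-periodic P k P-periodic zero    = cong (λ n → ∣ sieve P n ∣) (*-zeroʳ k)
∣sieve∣-periodic P k P-periodic (suc m) = begin
  ∣ sieve P (k * suc m) ∣                        ≡⟨ cong (λ n → ∣ sieve P n ∣) (*-suc k m) ⟩
  ∣ sieve P (k + k * m) ∣                        ≡⟨ ∣sieve∣-+ P k (k * m) ⟩
  ∣ sieve P k ∣ + ∣ sieve (P ∘ (k +_)) (k * m) ∣ ≡⟨ cong (λ (s : Subset (k * m)) → ∣ sieve P k ∣ + ∣ s ∣)
                                                     (tabulate-cong (P-periodic ∘ toℕ)) ⟩
  ∣ sieve P k ∣ + ∣ sieve P (k * m) ∣            ≡⟨ cong (∣ sieve P k ∣ +_)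
                                                     (∣sieve∣-periodic P k P-periodic m) ⟩
  ∣ sieve P k ∣ + m * ∣ sieve P k ∣              ∎
  where open ≡-Reasoning

∣sieve∣≡n : ∀ P n → (∀ x → x < n → T (P x)) → ∣ sieve P n ∣ ≡ n
∣sieve∣≡n P zero    all = refl
∣sieve∣≡n P (suc n) all with P 0 | all 0 (s≤s z≤n)
... | true | _ = cong suc (∣sieve∣≡n (P ∘ suc) n (λ x x<n → all (suc x) (s≤s x<n)))

nonMultiple : ℕ → ℕ → Bool
nonMultiple d x = isNo (d ∣? x)

nonMultiple-periodic : ∀ d x → nonMultiple d (d + x) ≡ nonMultiple d x
nonMultiple-periodic d x with d ∣? (d + x) | d ∣? x
... | yes _       | yes _   = refl
... | no  _       | no  _   = refl
... | yes d∣d+x   | no  d∤x = contradiction (∣m+n∣m⇒∣n d∣d+x ∣-refl) d∤x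
... | no  d∤d+x   | yes d∣x = contradiction (∣m∣n⇒∣m+n ∣-refl d∣x) d∤d+x

∣nonMultiples<1+d∣ : ∀ d → ∣ sieve (nonMultiple (suc d)) (suc d) ∣ ≡ d
∣nonMultiples<1+d∣ d = ∣sieve∣≡n (nonMultiple (suc d) ∘ suc) d
  (λ x x<d → fromWitnessFalse {a? = suc d ∣? suc x} (>⇒∤ (s≤s x<d)))

∣nonMultiples<d*m∣ : ∀ d m → ∣ sieve (nonMultiple d) (d * m) ∣ ≡ (d ∸ 1) * m
∣nonMultiples<d*m∣ zero    m = refl
∣nonMultiples<d*m∣ (suc d) m = begin
  ∣ sieve (nonMultiple (suc d)) (suc d * m) ∣ ≡⟨ ∣sieve∣-periodic (nonMultiple (suc d)) (suc d)
                                                   (nonMultiple-periodic (suc d)) m ⟩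
  m * ∣ sieve (nonMultiple (suc d)) (suc d) ∣ ≡⟨ cong (m *_) (∣nonMultiples<1+d∣ d) ⟩
  m * d                                       ≡⟨ *-comm m d ⟩
  d * m                                       ∎
  where open ≡-Reasoning

k∣n⇒k∣mulZn : ∀ n k .{{_ : NonZero n}} (x : Fin n) → k ∣ n → k ∣ toℕ (mulZn n k x)
k∣n⇒k∣mulZn n k x k∣n = subst (k ∣_) (sym (toℕ-fromℕ< _)) (%-presˡ-∣ (m∣m*n (toℕ x)) k∣n)

nonMultiples-kFree : ∀ k m .{{_ : NonZero (k * m)}} → IsKFree (k * m) k (sieve (nonMultiple k) (k * m))
nonMultiples-kFree k m x _ kx∈ =
  toWitnessFalse (∈-sieve⁻ (nonMultiple k) kx∈) (k∣n⇒k∣mulZn (k * m) k x (m∣m*n m))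

module _ (k m : ℕ) (2≤k : 2 ≤ k) (k∤m : ¬ k ∣ m) .{{_ : NonZero (k * m)}} where

  private
    n : ℕ
    n = k * m

    instance
      k≢0 : NonZero k
      k≢0 = m*n≢0⇒m≢0 k
      m≢0 : NonZero m
      m≢0 = m*n≢0⇒n≢0 k

    m+m≤n : m + m ≤ n
    m+m≤n = subst (_≤ n) (cong (m +_) (+-identityʳ m)) (*-monoˡ-≤ m 2≤k)

  lift : ℕ → ℕ
  lift a with k ∣? a
  ... | yes _ = a + m
  ... | no  _ = a

  lift-< : ∀ {a} → a < m → lift a < n
  lift-< {a} a<m with k ∣? a
  ... | yes _ = <-≤-trans (+-monoˡ-< m a<m) m+m≤n
  ... | no  _ = <-≤-trans a<m (≤-trans (m≤m+n m m) m+m≤n)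

  k∤lift : ∀ a → ¬ k ∣ lift a
  k∤lift a with k ∣? a
  ... | yes k∣a = λ k∣a+m → k∤m (∣m+n∣m⇒∣n k∣a+m k∣a)
  ... | no  k∤a = k∤a

  lift%m : ∀ {a} → a < m → lift a % m ≡ a
  lift%m {a} a<m with k ∣? a
  ... | yes _ = trans ([m+n]%n≡m%n a m) (m<n⇒m%n≡m a<m)
  ... | no  _ = m<n⇒m%n≡m a<m

  k*lift%n : ∀ {a} → a < m → k * lift a % n ≡ k * a
  k*lift%n {a} a<m with k ∣? a
  ... | yes _ = begin
    k * (a + m) % n      ≡⟨ cong (_% n) (*-distribˡ-+ k a m) ⟩
    (k * a + n) % n      ≡⟨ [m+n]%n≡m%n (k * a) n ⟩
    k * a % n            ≡⟨ m<n⇒m%n≡m (*-monoʳ-< k a<m) ⟩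
    k * a                ∎
    where open ≡-Reasoning
  ... | no  _ = m<n⇒m%n≡m (*-monoʳ-< k a<m)

  lifted : Fin m → Fin n
  lifted a = fromℕ< (lift-< (toℕ<n a))

  toℕ-k*lifted : ∀ a → toℕ (mulZn n k (lifted a)) ≡ k * toℕ a
  toℕ-k*lifted a = begin
    toℕ (mulZn n k (lifted a)) ≡⟨ toℕ-fromℕ< _ ⟩
    k * toℕ (lifted a) % n     ≡⟨ cong (λ v → k * v % n) (toℕ-fromℕ< _) ⟩
    k * lift (toℕ a) % n       ≡⟨ k*lift%n (toℕ<n a) ⟩
    k * toℕ a                  ∎
    where open ≡-Reasoning

  lifted-injective : Injective _≡_ _≡_ lifted
  lifted-injective {a} {b} eq = toℕ-injective (begin
    toℕ a                ≡⟨ lift%m (toℕ<n a) ⟨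
    lift (toℕ a) % m     ≡⟨ cong (_% m) (toℕ-fromℕ< _) ⟨
    toℕ (lifted a) % m   ≡⟨ cong (λ x → toℕ x % m) eq ⟩
    toℕ (lifted b) % m   ≡⟨ cong (_% m) (toℕ-fromℕ< _) ⟩
    lift (toℕ b) % m     ≡⟨ lift%m (toℕ<n b) ⟩
    toℕ b                ∎)
    where open ≡-Reasoning

  k*lifted-injective : Injective _≡_ _≡_ (mulZn n k ∘ lifted)
  k*lifted-injective {a} {b} eq = toℕ-injective (*-cancelˡ-≡ (toℕ a) (toℕ b) k
    (trans (sym (toℕ-k*lifted a)) (trans (cong toℕ eq) (toℕ-k*lifted b))))

  lifted≢k*lifted : ∀ a b → lifted a ≢ mulZn n k (lifted b)
  lifted≢k*lifted a b eq = k∤lift (toℕ a)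
    (subst (k ∣_) (trans (sym (cong toℕ eq)) (toℕ-fromℕ< _)) (k∣n⇒k∣mulZn n k _ (m∣m*n m)))

  kFree⇒∣p∣≤[k∸1]*m : (A : Subset n) → IsKFree n k A → ∣ A ∣ ≤ (k ∸ 1) * m
  kFree⇒∣p∣≤[k∸1]*m A A-free = subst (∣ A ∣ ≤_) n∸m≡[k∸1]*m
    (free⇒∣p∣≤n∸m (mulZn n k) lifted lifted-injective k*lifted-injective lifted≢k*lifted A A-free)
    where
    n∸m≡[k∸1]*m : n ∸ m ≡ (k ∸ 1) * m
    n∸m≡[k∸1]*m = sym (trans (*-distribʳ-∸ m k 1) (cong (n ∸_) (+-identityʳ m)))

theorem2 : (k m : ℕ) → k ≥ 1 → m ≥ 1 → ¬ (k ∣ m) →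
    .{{_ : NonZero (k * m)}} → IsRk (k * m) k ((k ∸ 1) * m)
theorem2 zero                m () _ _
theorem2 (suc zero)          m _  _ 1∤m = contradiction (1∣ m) 1∤m
theorem2 k@(suc (suc _))     m _  _ k∤m =
  (sieve (nonMultiple k) (k * m) , nonMultiples-kFree k m , ∣nonMultiples<d*m∣ k m) ,
  kFree⇒∣p∣≤[k∸1]*m k m (s≤s (s≤s z≤n)) k∤m
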